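{- Let $\chi:\bar\Gamma_0(2)\to\mathbf{C}^\times$ be a character with $\chi(\bar U)$ a primitive $n$-th root of unity and $\chi(\bar V)=\varepsilon\in\{\pm1\}$. Put $H=\ker\chi$, $H_0=H\cap\bar\Gamma(2)$, $H_1=H_0\langle\bar V\rangle$, $H_2=H\langle\bar V\rangle$. Then exactly one of the following holds: (A) $n$ odd, $\varepsilon=-1$, $H=H_0$ and $H_1=H_2$; (B) $n$ odd, $\varepsilon=+1$ and $H=H_1=H_2$; (C) $n$ even, $\varepsilon=-1$, the four groups $H,H_0,H_1,H_2$ are pairwise distinct and $|H_2:H_0|=4$; (D) $n$ even, $\varepsilon=+1$ and $H=H_1=H_2$. Moreover in all cases $|H_1:H_0|=2$.
   Context: $\Gamma=\mathrm{PSL}_2(\mathbf{Z})$; bars denote images in $\Gamma$; $T=\begin{pmatrix}1&1\\0&1\end{pmatrix}$, $U=\begin{pmatrix}1&0\\2&1\end{pmatrix}$, $V=TU^{ -1}=\begin{pmatrix}-1&1\\-2&1\end{pmatrix}$; $\bar\Gamma(2)$, $\bar\Gamma_0(2)$ are images of the usual congruence subgroups. -}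

module Defs where

open import Data.Nat using (ℕ; zero; suc; NonZero)
open import Data.Integer as ℤ using (ℤ; +_; -[1+_])
open import Data.Integer.Divisibility using () renaming (_∣_ to _∣ℤ_)
open import Data.Rational as ℚ using (ℚ; _/_)
open import Data.Sign using (Sign)
open import Data.Fin using (Fin)
open import Data.Product using (Σ; ∃; ∃-syntax; _×_; _,_)
open import Data.Sum using (_⊎_)
open import Relation.Nullary using (¬_)
open import Relation.Binary.PropositionalEquality using (_≡_)

-- 2x2 integer matrices; SL₂(ℤ) = those of determinant 1.
-- PSL₂(ℤ) = SL₂(ℤ)/{±I}: elements of Γ̄ are represented by matrices of
-- determinant 1, two matrices representing the same element iff g ≡ ±h.

record M2 : Set where
  constructor mat
  field
    a b c d : ℤ
open M2 public

_·_ : M2 → M2 → M2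
mat a b c d · mat a' b' c' d' =
  mat (a ℤ.* a' ℤ.+ b ℤ.* c') (a ℤ.* b' ℤ.+ b ℤ.* d')
      (c ℤ.* a' ℤ.+ d ℤ.* c') (c ℤ.* b' ℤ.+ d ℤ.* d')
infixl 7 _·_

neg : M2 → M2
neg (mat a b c d) = mat (ℤ.- a) (ℤ.- b) (ℤ.- c) (ℤ.- d)

det : M2 → ℤ
det (mat a b c d) = a ℤ.* d ℤ.- b ℤ.* c

inv : M2 → M2
inv (mat a b c d) = mat d (ℤ.- b) (ℤ.- c) a

I T U V : M2
I = mat (+ 1) (+ 0) (+ 0) (+ 1)
T = mat (+ 1) (+ 1) (+ 0) (+ 1)
U = mat (+ 1) (+ 0) (+ 2) (+ 1)
V = mat (ℤ.- + 1) (+ 1) (ℤ.- + 2) (+ 1)   -- = T · inv U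

powℕ : M2 → ℕ → M2
powℕ g zero = I
powℕ g (suc k) = g · powℕ g k

pow : M2 → ℤ → M2
pow g (+ k) = powℕ g k
pow g -[1+ k ] = powℕ (inv g) (suc k)

_≈±_ : M2 → M2 → Set
g ≈± h = (g ≡ h) ⊎ (g ≡ neg h)

InSL2 : M2 → Set
InSL2 g = det g ≡ + 1

InΓ₀2 : M2 → Set
InΓ₀2 g = InSL2 g × (+ 2 ∣ℤ c g)

InΓ2 : M2 → Set
InΓ2 g = InSL2 g × (+ 2 ∣ℤ b g) × (+ 2 ∣ℤ c g)

-- C^× is not available; a character χ of Γ̄₀(2) whose values
-- are roots of unity is written χ = exp(2πi θ) with θ valued in ℚ/ℤ.
-- ℚ/ℤ is represented by ℚ with equality "difference is an integer".

IsInt : ℚ → Set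
IsInt q = ℚ.denominatorℕ q ≡ 1

_≡ℚ/ℤ_ : ℚ → ℚ → Set
x ≡ℚ/ℤ y = IsInt (x ℚ.- y)

_•_ : ℕ → ℚ → ℚ
k • q = ((+ k) / 1) ℚ.* q

-- θ : matrices → ℚ is (the logarithm of) a character of Γ̄₀(2):
-- a homomorphism Γ₀(2) → ℚ/ℤ which is trivial on -I (factors through PSL).
-- Values of θ outside Γ₀(2) are irrelevant.
record IsCharacter (θ : M2 → ℚ) : Set where
  field
    hom   : ∀ g h → InΓ₀2 g → InΓ₀2 h → θ (g · h) ≡ℚ/ℤ (θ g ℚ.+ θ h)
    ±-inv : ∀ g → InΓ₀2 g → θ (neg g) ≡ℚ/ℤ θ g

-- exp(2πi q) is a primitive n-th root of unity
PrimitiveRoot : ℕ → ℚ → Set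
PrimitiveRoot n q = IsInt (n • q) × (∀ m → 0 Data.Nat.< m → m Data.Nat.< n → ¬ IsInt (m • q))

-- the sign ε ∈ {±1} as an element of ℚ/ℤ : +1 ↦ 0, -1 ↦ 1/2
signℚ : Sign → ℚ
signℚ Sign.+ = ℚ.0ℚ
signℚ Sign.- = ℚ.½

Pred : Set₁
Pred = M2 → Set

_⟨_⟩ : Pred → M2 → Pred
(A ⟨ v ⟩) g = ∃[ h ] ∃[ k ] (A h × (g ≈± (h · pow v k)))

_∩_ : Pred → Pred → Pred
(A ∩ B) g = A g × B g

_≐_ : Pred → Pred → Set
A ≐ B = ∀ g → InSL2 g → ((A g → B g) × (B g → A g))

-- |B : A| = m : there are m elements r₀,…,r_{m-1} of B such that every
-- g ∈ B lies in exactly one right coset A rᵢ (i.e. g rᵢ⁻¹ ∈ A).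
record Index (B A : Pred) (m : ℕ) : Set where
  field
    rep      : Fin m → M2
    rep∈     : ∀ i → B (rep i)
    covers   : ∀ g → InSL2 g → B g → ∃[ i ] A (g · inv (rep i))
    disjoint : ∀ g i j → InSL2 g → B g →
               A (g · inv (rep i)) → A (g · inv (rep j)) → i ≡ j

ExactlyOne4 : Set → Set → Set → Set → Set
ExactlyOne4 P Q R S =
  (P ⊎ Q ⊎ R ⊎ S) ×
  ¬ (P × Q) × ¬ (P × R) × ¬ (P × S) × ¬ (Q × R) × ¬ (Q × S) × ¬ (R × S)

-- The crux is that χⁿ is trivial on Γ̄(2): Γ̄(2) is generated by Ū and T̄²
-- (a Euclidean descent on the matrix entries), χ(Ū)ⁿ = 1, and χ(T̄²) = χ(V̄Ū)² = χ(Ū)² since V̄² = 1.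
-- Right multiplication by V̄ swaps Γ̄(2) and Γ̄₀(2) ∖ Γ̄(2). If ε = +1 then V̄ ∈ H, so H = H₀⟨V̄⟩ = H⟨V̄⟩.
-- If ε = −1 and g ∈ H ∖ Γ̄(2), then gV̄ ∈ Γ̄(2) has χ(gV̄) = −1, so −1 is an n-th root of unity and n
-- is even. Conversely, for n = 2m the element w = ŪᵐV̄ lies in H ∖ Γ̄(2), and H₂ is the disjoint union
-- of the H₀-cosets of 1, V̄, w and wV̄, which are told apart by membership in Γ̄(2) and in H.

module Submission where

open import Defs
open import Data.Nat as ℕ using (ℕ; zero; suc; NonZero; _<_; z≤n; s≤s)
import Data.Nat.Properties as ℕP
import Data.Nat.Divisibility as ℕD
open import Data.Nat.Divisibility using (_∣_; _∣?_)
import Data.Nat.Coprimality as Coprimality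
open import Data.Nat.Induction using (<-wellFounded)
open import Data.Integer as ℤ using (ℤ; +_; -[1+_]; -_; _+_; _-_; _*_; ∣_∣)
import Data.Integer.Properties as ℤP
import Data.Integer.DivMod as ℤDivMod
import Data.Integer.GCD as ℤGCD
open import Data.Integer.Divisibility using () renaming (_∣_ to _∣ℤ_)
import Data.Integer.Divisibility.Signed as Signed
open import Data.Integer.Tactic.RingSolver using (solve-∀)
open import Data.Rational as ℚ using (ℚ; mkℚ; _/_; ½)
import Data.Rational.Properties as ℚP
open import Data.Rational.Solver using (module +-*-Solver)
open +-*-Solver
open import Data.Sign using (Sign)
open import Data.Fin using (Fin; zero; suc)
open import Data.Product using (∃-syntax; _×_; _,_; proj₁; proj₂)
open import Data.Sum using (_⊎_; inj₁; inj₂; fromInj₂)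
open import Data.Empty using (⊥; ⊥-elim)
open import Function.Base using (_∘_)
open import Function.Bundles using (_⇔_; mk⇔; Equivalence)
open Equivalence using (to; from)
open import Induction.WellFounded using (Acc; acc)
open import Relation.Nullary using (¬_; Dec; yes; no)
open import Relation.Binary.Bundles using (Setoid)
open import Relation.Binary.Structures using (IsEquivalence)
open import Relation.Binary.Definitions using (tri<; tri≈; tri>)
import Relation.Binary.Reasoning.Setoid as SetoidReasoning
open import Relation.Binary.PropositionalEquality

-- ℚ modulo ℤ

-- The records make their index inferable, which IsInt q and IsInt (x ℚ.- y) do not.
record Integral (q : ℚ) : Set where
  constructor integral
  field isInt : IsInt q
open Integral public

infix 4 _~_
record _~_ (x y : ℚ) : Set where
  constructor congruent
  field difference : Integral (x ℚ.- y)
open _~_ public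

≡ℚ/ℤ⇒~ : ∀ {x y} → x ≡ℚ/ℤ y → x ~ y
≡ℚ/ℤ⇒~ x≡y = congruent (integral x≡y)

~⇒≡ℚ/ℤ : ∀ {x y} → x ~ y → x ≡ℚ/ℤ y
~⇒≡ℚ/ℤ x~y = isInt (difference x~y)

fromℤ : ℤ → ℚ
fromℤ x = mkℚ x 0 (Coprimality.sym (Coprimality.1-coprimeTo ℤ.∣ x ∣))

/1≡fromℤ : ∀ x → x / 1 ≡ fromℤ x
/1≡fromℤ x = ℚP.↥p/↧p≡p (fromℤ x)

integral-/1 : ∀ x → Integral (x / 1)
integral-/1 x rewrite /1≡fromℤ x = integral refl

integral⇒≡/1 : ∀ {p} → Integral p → p ≡ ℚ.↥ p / 1
integral⇒≡/1 {mkℚ x 0 _} (integral refl) = sym (/1≡fromℤ x)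

/1-+ : ∀ x y → (x ℤ.+ y) / 1 ≡ (x / 1) ℚ.+ (y / 1)
/1-+ x y rewrite /1≡fromℤ x | /1≡fromℤ y =
  cong (_/ 1) (sym (cong₂ ℤ._+_ (ℤP.*-identityʳ x) (ℤP.*-identityʳ y)))

/1-* : ∀ x y → (x ℤ.* y) / 1 ≡ (x / 1) ℚ.* (y / 1)
/1-* x y rewrite /1≡fromℤ x | /1≡fromℤ y = refl

integral-+ : ∀ {p q} → Integral p → Integral q → Integral (p ℚ.+ q)
integral-+ {mkℚ x 0 _} {mkℚ y 0 _} (integral refl) (integral refl) = integral-/1 (x ℤ.* + 1 ℤ.+ y ℤ.* + 1)

integral-* : ∀ {p q} → Integral p → Integral q → Integral (p ℚ.* q)
integral-* {mkℚ x 0 _} {mkℚ y 0 _} (integral refl) (integral refl) = integral-/1 (x ℤ.* y)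

integral-neg : ∀ {p} → Integral p → Integral (ℚ.- p)
integral-neg {mkℚ (+ 0) 0 _} (integral refl) = integral refl
integral-neg {mkℚ (+ suc _) 0 _} (integral refl) = integral refl
integral-neg {mkℚ ℤ.-[1+ _ ] 0 _} (integral refl) = integral refl

integral-• : ∀ k {p} → Integral p → Integral (k • p)
integral-• k = integral-* (integral-/1 (+ k))

¬integral-½ : ¬ Integral ½
¬integral-½ (integral ())

~-reflexive : ∀ {x y} → x ≡ y → x ~ y
~-reflexive {x} refl = congruent (subst Integral (sym (ℚP.+-inverseʳ x)) (integral refl))

~-refl : ∀ {x} → x ~ x
~-refl = ~-reflexive refl

~-sym : ∀ {x y} → x ~ y → y ~ x
~-sym {x} {y} (congruent i) =
  congruent (subst Integral (solve 2 (λ x y → :- (x :- y) := y :- x) refl x y) (integral-neg i))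

~-trans : ∀ {x y z} → x ~ y → y ~ z → x ~ z
~-trans {x} {y} {z} (congruent i) (congruent j) =
  congruent (subst Integral (solve 3 (λ x y z → (x :- y) :+ (y :- z) := x :- z) refl x y z) (integral-+ i j))

~-isEquivalence : IsEquivalence _~_
~-isEquivalence = record { refl = ~-refl ; sym = ~-sym ; trans = ~-trans }

~-setoid : Setoid _ _
~-setoid = record { isEquivalence = ~-isEquivalence }

module ~-Reasoning = SetoidReasoning ~-setoid

~-+ : ∀ {x x′ y y′} → x ~ x′ → y ~ y′ → x ℚ.+ y ~ x′ ℚ.+ y′
~-+ {x} {x′} {y} {y′} (congruent i) (congruent j) = congruent (subst Integral
  (solve 4 (λ x x′ y y′ → (x :- x′) :+ (y :- y′) := (x :+ y) :- (x′ :+ y′)) refl x x′ y y′) (integral-+ i j))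

~-• : ∀ k {x y} → x ~ y → k • x ~ k • y
~-• k {x} {y} (congruent i) = congruent (subst Integral
  (solve 3 (λ k x y → k :* (x :- y) := (k :* x) :- (k :* y)) refl (+ k / 1) x y) (integral-• k i))

integral-resp-~ : ∀ {x y} → x ~ y → Integral y → Integral x
integral-resp-~ {x} {y} (congruent i) j =
  subst Integral (solve 2 (λ x y → (x :- y) :+ y := x) refl x y) (integral-+ i j)

integral⇒~0 : ∀ {x} → Integral x → x ~ ℚ.0ℚ
integral⇒~0 {x} i = congruent (subst Integral (sym (ℚP.+-identityʳ x)) i)

~0⇒integral : ∀ {x} → x ~ ℚ.0ℚ → Integral x
~0⇒integral x~0 = integral-resp-~ x~0 (integral refl)

integral-+-cancelˡ : ∀ {x y} → Integral x → Integral (x ℚ.+ y) → Integral y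
integral-+-cancelˡ {x} {y} i j =
  subst Integral (solve 2 (λ x y → (x :+ y) :- x := y) refl x y) (integral-+ j (integral-neg i))

~-+-integralˡ : ∀ {x y} → Integral x → x ℚ.+ y ~ y
~-+-integralˡ {x} {y} i = congruent (subst Integral (solve 2 (λ x y → x := (x :+ y) :- y) refl x y) i)

~-double⇒integral : ∀ {x} → x ~ x ℚ.+ x → Integral x
~-double⇒integral {x} (congruent i) =
  subst Integral (solve 1 (λ x → :- (x :- (x :+ x)) := x) refl x) (integral-neg i)

integral-+⇒~-neg : ∀ {x y} → Integral (x ℚ.+ y) → x ~ ℚ.- y
integral-+⇒~-neg {x} {y} i = congruent (subst Integral (solve 2 (λ x y → x :+ y := x :- (:- y)) refl x y) i)

•-distribˡ-+ : ∀ k x y → k • (x ℚ.+ y) ≡ k • x ℚ.+ k • y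
•-distribˡ-+ k x y = solve 3 (λ k x y → k :* (x :+ y) := k :* x :+ k :* y) refl (+ k / 1) x y

•-zero : ∀ x → 0 • x ≡ ℚ.0ℚ
•-zero = ℚP.*-zeroˡ

•-suc : ∀ k x → suc k • x ≡ x ℚ.+ k • x
•-suc k x = trans (cong (ℚ._* x) (/1-+ (+ 1) (+ k)))
  (solve 2 (λ k x → (con ℚ.1ℚ :+ k) :* x := x :+ k :* x) refl (+ k / 1) x)

•-assoc : ∀ j k x → j • (k • x) ≡ (k ℕ.* j) • x
•-assoc j k x = trans (solve 3 (λ j k x → j :* (k :* x) := (k :* j) :* x) refl (+ j / 1) (+ k / 1) x)
  (cong (ℚ._* x) (trans (sym (/1-* (+ k) (+ j))) (cong (_/ 1) (sym (ℤP.pos-* k j)))))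

integral-double⇒integral⊎half : ∀ q → Integral (2 • q) → Integral q ⊎ Integral (q ℚ.+ ½)
integral-double⇒integral⊎half q i = split (z ℤDivMod.% + 2) (ℤDivMod.n%d<d z (+ 2)) (ℤDivMod.a≡a%n+[a/n]*n z (+ 2))
  where
  z = ℚ.↥ (2 • q)
  k = z ℤDivMod./ + 2
  q≡ : ∀ r → z ≡ + r ℤ.+ k ℤ.* + 2 → q ≡ (+ r / 1) ℚ.* ½ ℚ.+ k / 1
  q≡ r z≡ = begin
    q
      ≡⟨ solve 1 (λ q → q := (con (+ 2 / 1) :* q) :* con ½) refl q ⟩
    (2 • q) ℚ.* ½
      ≡⟨ cong (ℚ._* ½) (trans (integral⇒≡/1 i) (cong (_/ 1) z≡)) ⟩
    ((+ r ℤ.+ k ℤ.* + 2) / 1) ℚ.* ½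
      ≡⟨ cong (ℚ._* ½) (trans (/1-+ (+ r) (k ℤ.* + 2)) (cong (+ r / 1 ℚ.+_) (/1-* k (+ 2)))) ⟩
    ((+ r / 1) ℚ.+ (k / 1) ℚ.* (+ 2 / 1)) ℚ.* ½
      ≡⟨ solve 2 (λ r k → (r :+ k :* con (+ 2 / 1)) :* con ½ := r :* con ½ :+ k) refl (+ r / 1) (k / 1) ⟩
    (+ r / 1) ℚ.* ½ ℚ.+ k / 1
      ∎
    where open ≡-Reasoning
  split : ∀ r → r ℕ.< 2 → z ≡ + r ℤ.+ k ℤ.* + 2 → Integral q ⊎ Integral (q ℚ.+ ½)
  split 0 _ z≡ = inj₁ (subst Integral (sym (trans (q≡ 0 z≡) (ℚP.+-identityˡ (k / 1)))) (integral-/1 k))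
  split 1 _ z≡ = inj₂ (subst Integral
    (sym (trans (cong (ℚ._+ ½) (q≡ 1 z≡)) (solve 1 (λ k → con ½ :+ k :+ con ½ := k :+ con ℚ.1ℚ) refl (k / 1))))
    (integral-+ (integral-/1 k) (integral refl)))
  split (suc (suc _)) (ℕ.s≤s (ℕ.s≤s ())) _

integral-•½⇒even : ∀ n → Integral (n • ½) → 2 ∣ n
integral-•½⇒even n i = subst (2 ∣_) (cong ℤ.∣_∣ (ℤP.*-identityʳ (+ n)))
  (subst (λ g → ℤ.∣ g ∣ ∣ ℤ.∣ x ∣) gcd≡2 (ℤGCD.gcd[i,j]∣i x (+ 2)))
  where
  x = + n ℤ.* + 1
  n•½≡ : n • ½ ≡ x / 2
  n•½≡ = cong (ℚ._* ½) (/1≡fromℤ (+ n))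
  gcd≡2 : ℤGCD.gcd x (+ 2) ≡ + 2
  gcd≡2 = begin
    ℤGCD.gcd x (+ 2)                 ≡⟨ sym (ℤP.*-identityˡ _) ⟩
    + 1 ℤ.* ℤGCD.gcd x (+ 2)         ≡⟨ cong (λ d → + d ℤ.* ℤGCD.gcd x (+ 2)) (sym (isInt (subst Integral n•½≡ i))) ⟩
    ℚ.↧ (x / 2) ℤ.* ℤGCD.gcd x (+ 2) ≡⟨ ℚP.↧-/ x 2 ⟩
    + 2                              ∎
    where open ≡-Reasoning

-- 2 × 2 integer matrices

mat-cong : ∀ {a b c d a′ b′ c′ d′} → a ≡ a′ → b ≡ b′ → c ≡ c′ → d ≡ d′ → mat a b c d ≡ mat a′ b′ c′ d′
mat-cong refl refl refl refl = refl

·-assoc : ∀ g h k → (g · h) · k ≡ g · (h · k)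
·-assoc (mat a b c d) (mat p q r s) (mat x y z w) =
  mat-cong (entry a b p q r s x z) (entry a b p q r s y w) (entry c d p q r s x z) (entry c d p q r s y w)
  where
  entry : ∀ a b p q r s x z → (a * p + b * r) * x + (a * q + b * s) * z ≡ a * (p * x + q * z) + b * (r * x + s * z)
  entry = solve-∀

·-identityˡ : ∀ g → I · g ≡ g
·-identityˡ (mat a b c d) = mat-cong (entry₁ a c) (entry₁ b d) (entry₂ a c) (entry₂ b d)
  where
  entry₁ : ∀ x y → + 1 * x + + 0 * y ≡ x
  entry₁ = solve-∀
  entry₂ : ∀ x y → + 0 * x + + 1 * y ≡ y
  entry₂ = solve-∀

·-identityʳ : ∀ g → g · I ≡ g
·-identityʳ (mat a b c d) = mat-cong (entry₁ a b) (entry₂ a b) (entry₁ c d) (entry₂ c d)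
  where
  entry₁ : ∀ x y → x * + 1 + y * + 0 ≡ x
  entry₁ = solve-∀
  entry₂ : ∀ x y → x * + 0 + y * + 1 ≡ y
  entry₂ = solve-∀

neg-involutive : ∀ g → neg (neg g) ≡ g
neg-involutive (mat a b c d) =
  mat-cong (ℤP.neg-involutive a) (ℤP.neg-involutive b) (ℤP.neg-involutive c) (ℤP.neg-involutive d)

neg-distribˡ-· : ∀ g h → neg g · h ≡ neg (g · h)
neg-distribˡ-· (mat a b c d) (mat p q r s) = mat-cong (entry a b p r) (entry a b q s) (entry c d p r) (entry c d q s)
  where
  entry : ∀ x y u v → - x * u + - y * v ≡ - (x * u + y * v)
  entry = solve-∀

neg-distribʳ-· : ∀ g h → g · neg h ≡ neg (g · h)
neg-distribʳ-· (mat a b c d) (mat p q r s) = mat-cong (entry a b p r) (entry a b q s) (entry c d p r) (entry c d q s)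
  where
  entry : ∀ x y u v → x * - u + y * - v ≡ - (x * u + y * v)
  entry = solve-∀

det-· : ∀ g h → det (g · h) ≡ det g * det h
det-· (mat a b c d) (mat p q r s) = identity a b c d p q r s
  where
  identity : ∀ a b c d p q r s →
    (a * p + b * r) * (c * q + d * s) - (a * q + b * s) * (c * p + d * r) ≡ (a * d - b * c) * (p * s - q * r)
  identity = solve-∀

det-neg : ∀ g → det (neg g) ≡ det g
det-neg (mat a b c d) = identity a b c d
  where
  identity : ∀ a b c d → - a * - d - - b * - c ≡ a * d - b * c
  identity = solve-∀

det-inv : ∀ g → det (inv g) ≡ det g
det-inv (mat a b c d) = identity a b c d
  where
  identity : ∀ a b c d → d * a - - b * - c ≡ a * d - b * c
  identity = solve-∀

inv-· : ∀ g h → inv (g · h) ≡ inv h · inv g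
inv-· (mat a b c d) (mat p q r s) =
  mat-cong (entry₁ c d q s) (entry₂ a b q s) (entry₃ c d p r) (entry₄ a b p r)
  where
  entry₁ : ∀ c d q s → c * q + d * s ≡ s * d + - q * - c
  entry₁ = solve-∀
  entry₂ : ∀ a b q s → - (a * q + b * s) ≡ s * - b + - q * a
  entry₂ = solve-∀
  entry₃ : ∀ c d p r → - (c * p + d * r) ≡ - r * d + p * - c
  entry₃ = solve-∀
  entry₄ : ∀ a b p r → a * p + b * r ≡ - r * - b + p * a
  entry₄ = solve-∀

inv-inverseˡ : ∀ g → det g ≡ + 1 → inv g · g ≡ I
inv-inverseˡ (mat a b c d) det≡1 =
  mat-cong (trans (diagonal₁ a b c d) det≡1) (off-diagonal b d) (off-diagonal₂ a c) (trans (diagonal₂ a b c d) det≡1)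
  where
  diagonal₁ : ∀ a b c d → d * a + - b * c ≡ a * d - b * c
  diagonal₁ = solve-∀
  diagonal₂ : ∀ a b c d → - c * b + a * d ≡ a * d - b * c
  diagonal₂ = solve-∀
  off-diagonal : ∀ x y → y * x + - x * y ≡ + 0
  off-diagonal = solve-∀
  off-diagonal₂ : ∀ x y → - y * x + x * y ≡ + 0
  off-diagonal₂ = solve-∀

inv-inverseʳ : ∀ g → det g ≡ + 1 → g · inv g ≡ I
inv-inverseʳ (mat a b c d) det≡1 =
  mat-cong (trans (diagonal₁ a b c d) det≡1) (off-diagonal a b) (off-diagonal₂ c d) (trans (diagonal₂ a b c d) det≡1)
  where
  diagonal₁ : ∀ a b c d → a * d + b * - c ≡ a * d - b * c
  diagonal₁ = solve-∀
  diagonal₂ : ∀ a b c d → c * - b + d * a ≡ a * d - b * c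
  diagonal₂ = solve-∀
  off-diagonal : ∀ x y → x * - y + y * x ≡ + 0
  off-diagonal = solve-∀
  off-diagonal₂ : ∀ x y → x * y + y * - x ≡ + 0
  off-diagonal₂ = solve-∀

·-inv-cancelʳ : ∀ g r → det r ≡ + 1 → (g · inv r) · r ≡ g
·-inv-cancelʳ g r det≡1 = begin
  (g · inv r) · r ≡⟨ ·-assoc g (inv r) r ⟩
  g · (inv r · r) ≡⟨ cong (g ·_) (inv-inverseˡ r det≡1) ⟩
  g · I           ≡⟨ ·-identityʳ g ⟩
  g               ∎
  where open ≡-Reasoning

·-cancelʳ-inv : ∀ g r → det r ≡ + 1 → (g · r) · inv r ≡ g
·-cancelʳ-inv g r det≡1 = begin
  (g · r) · inv r ≡⟨ ·-assoc g r (inv r) ⟩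
  g · (r · inv r) ≡⟨ cong (g ·_) (inv-inverseʳ r det≡1) ⟩
  g · I           ≡⟨ ·-identityʳ g ⟩
  g               ∎
  where open ≡-Reasoning

inv-·-cancelˡ : ∀ x r → det x ≡ + 1 → inv x · (x · r) ≡ r
inv-·-cancelˡ x r det≡1 = begin
  inv x · (x · r) ≡⟨ ·-assoc (inv x) x r ⟨
  (inv x · x) · r ≡⟨ cong (_· r) (inv-inverseˡ x det≡1) ⟩
  I · r           ≡⟨ ·-identityˡ r ⟩
  r               ∎
  where open ≡-Reasoning

·-inv-·-cancelʳ : ∀ h v w → det v ≡ + 1 → (h · v) · inv (w · v) ≡ h · inv w
·-inv-·-cancelʳ h v w det≡1 = begin
  (h · v) · inv (w · v)       ≡⟨ cong ((h · v) ·_) (inv-· w v) ⟩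
  (h · v) · (inv v · inv w)   ≡⟨ ·-assoc (h · v) (inv v) (inv w) ⟨
  ((h · v) · inv v) · inv w   ≡⟨ cong (_· inv w) (·-cancelʳ-inv h v det≡1) ⟩
  h · inv w                   ∎
  where open ≡-Reasoning

·V·V : ∀ g → (g · V) · V ≡ neg g
·V·V g = begin
  (g · V) · V ≡⟨ ·-assoc g V V ⟩
  g · neg I   ≡⟨ neg-distribʳ-· g I ⟩
  neg (g · I) ≡⟨ cong neg (·-identityʳ g) ⟩
  neg g       ∎
  where open ≡-Reasoning

-- Equality in PSL₂(ℤ)

≈±-refl : ∀ {g} → g ≈± g
≈±-refl = inj₁ refl

≈±-reflexive : ∀ {g h} → g ≡ h → g ≈± h
≈±-reflexive = inj₁

≈±-sym : ∀ {g h} → g ≈± h → h ≈± g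
≈±-sym (inj₁ refl) = inj₁ refl
≈±-sym {h = h} (inj₂ refl) = inj₂ (sym (neg-involutive h))

≈±-trans : ∀ {g h k} → g ≈± h → h ≈± k → g ≈± k
≈±-trans g≈h (inj₁ refl) = g≈h
≈±-trans (inj₁ refl) (inj₂ refl) = inj₂ refl
≈±-trans {k = k} (inj₂ refl) (inj₂ refl) = inj₁ (neg-involutive k)

≈±-·ʳ : ∀ {g h} r → g ≈± h → (g · r) ≈± (h · r)
≈±-·ʳ r (inj₁ refl) = inj₁ refl
≈±-·ʳ {h = h} r (inj₂ refl) = inj₂ (neg-distribˡ-· h r)

≈±-·ˡ : ∀ {g h} r → g ≈± h → (r · g) ≈± (r · h)
≈±-·ˡ r (inj₁ refl) = inj₁ refl
≈±-·ˡ {h = h} r (inj₂ refl) = inj₂ (neg-distribʳ-· r h)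

powℕ-involution : ∀ x → (x · x) ≈± I → ∀ k → powℕ x k ≈± I ⊎ powℕ x k ≈± x
powℕ-involution x x²≈I zero = inj₁ ≈±-refl
powℕ-involution x x²≈I (suc k) with powℕ-involution x x²≈I k
... | inj₁ xᵏ≈I = inj₂ (≈±-trans (≈±-·ˡ x xᵏ≈I) (≈±-reflexive (·-identityʳ x)))
... | inj₂ xᵏ≈x = inj₁ (≈±-trans (≈±-·ˡ x xᵏ≈x) x²≈I)

pow-V : ∀ k → pow V k ≈± I ⊎ pow V k ≈± V
pow-V (+ k) = powℕ-involution V (inj₂ refl) k
pow-V -[1+ k ] with powℕ-involution (inv V) (inj₂ refl) (suc k)
... | inj₁ ≈I = inj₁ ≈I
... | inj₂ ≈invV = inj₂ (≈±-trans ≈invV (inj₂ refl))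

·V·V-≈± : ∀ g → g ≈± ((g · V) · V)
·V·V-≈± g = ≈±-sym {(g · V) · V} {g} (inj₂ (·V·V g))

⟨V⟩-cases : ∀ {A g} → (A ⟨ V ⟩) g → ∃[ h ] A h × (g ≈± h ⊎ g ≈± (h · V))
⟨V⟩-cases (h , k , A-h , g≈hVᵏ) with pow-V k
... | inj₁ Vᵏ≈I = h , A-h , inj₁ (≈±-trans g≈hVᵏ (≈±-trans (≈±-·ˡ h Vᵏ≈I) (≈±-reflexive (·-identityʳ h))))
... | inj₂ Vᵏ≈V = h , A-h , inj₂ (≈±-trans g≈hVᵏ (≈±-·ˡ h Vᵏ≈V))

⟨V⟩-intro : ∀ {A g} h → A h → g ≈± h → (A ⟨ V ⟩) g
⟨V⟩-intro h A-h g≈h = h , + 0 , A-h , ≈±-trans g≈h (≈±-reflexive (sym (·-identityʳ h)))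

⟨V⟩-intro-·V : ∀ {A g} h → A h → g ≈± (h · V) → (A ⟨ V ⟩) g
⟨V⟩-intro-·V h A-h g≈hV = h , + 1 , A-h , g≈hV

-- Parity and the congruence subgroups Γ₀(2), Γ(2)

Even : ℤ → Set
Even x = + 2 ∣ℤ x

private
  even⇒2∣ : ∀ x → Even x → + 2 Signed.∣ x
  even⇒2∣ x = Signed.∣ᵤ⇒∣ {+ 2} {x}

  2∣⇒even : ∀ x → + 2 Signed.∣ x → Even x
  2∣⇒even x = Signed.∣⇒∣ᵤ {+ 2} {x}

even-+ : ∀ x y → Even x → Even y → Even (x + y)
even-+ x y p q = 2∣⇒even (x + y) (Signed.∣m∣n⇒∣m+n (even⇒2∣ x p) (even⇒2∣ y q))

even-neg : ∀ x → Even x → Even (- x)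
even-neg x p = 2∣⇒even (- x) (Signed.∣m⇒∣-m (even⇒2∣ x p))

even-*ˡ : ∀ x y → Even y → Even (x * y)
even-*ˡ x y p = 2∣⇒even (x * y) (Signed.∣n⇒∣m*n x (even⇒2∣ y p))

even-*ʳ : ∀ x y → Even x → Even (x * y)
even-*ʳ x y p = 2∣⇒even (x * y) (Signed.∣m⇒∣m*n y (even⇒2∣ x p))

even-+-cancelʳ : ∀ x y → Even (x + y) → Even y → Even x
even-+-cancelʳ x y p q = 2∣⇒even x (Signed.∣m+n∣n⇒∣m (even⇒2∣ (x + y) p) (even⇒2∣ y q))

¬even-1 : ¬ Even (+ 1)
¬even-1 p with ℕD.∣1⇒≡1 p
... | ()

even? : ∀ x → Dec (Even x)
even? x = 2 ℕD.∣? ℤ.∣ x ∣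

odd⇒≡1+2k : ∀ x → ¬ Even x → x ≡ + 1 + (x ℤDivMod./ + 2) * + 2
odd⇒≡1+2k x odd = remainder (x ℤDivMod.% + 2) (ℤDivMod.n%d<d x (+ 2)) (ℤDivMod.a≡a%n+[a/n]*n x (+ 2))
  where
  remainder : ∀ r → r ℕ.< 2 → x ≡ + r + (x ℤDivMod./ + 2) * + 2 → x ≡ + 1 + (x ℤDivMod./ + 2) * + 2
  remainder 0 _ x≡ = ⊥-elim (odd (2∣⇒even x (Signed.divides (x ℤDivMod./ + 2) (trans x≡ (ℤP.+-identityˡ _)))))
  remainder 1 _ x≡ = x≡
  remainder (suc (suc _)) (ℕ.s≤s (ℕ.s≤s ())) _

odd-+-odd : ∀ x y → ¬ Even x → ¬ Even y → Even (x + y)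
odd-+-odd x y odd-x odd-y = 2∣⇒even (x + y) (Signed.divides (+ 1 + x ℤDivMod./ + 2 + y ℤDivMod./ + 2)
  (trans (cong₂ _+_ (odd⇒≡1+2k x odd-x) (odd⇒≡1+2k y odd-y)) (identity (x ℤDivMod./ + 2) (y ℤDivMod./ + 2))))
  where
  identity : ∀ k l → (+ 1 + k * + 2) + (+ 1 + l * + 2) ≡ (+ 1 + k + l) * + 2
  identity = solve-∀

even-0 : Even (+ 0)
even-0 = ℕD._∣0 2

even-2 : Even (+ 2)
even-2 = ℕD.∣-refl

Γ₀2-· : ∀ g h → InΓ₀2 g → InΓ₀2 h → InΓ₀2 (g · h)
Γ₀2-· g@(mat a b c d) h@(mat p q r s) (det-g , 2∣c) (det-h , 2∣r) =
  trans (det-· g h) (cong₂ _*_ det-g det-h) , even-+ (c * p) (d * r) (even-*ʳ c p 2∣c) (even-*ˡ d r 2∣r)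

Γ₀2-neg : ∀ g → InΓ₀2 g → InΓ₀2 (neg g)
Γ₀2-neg g@(mat a b c d) (det-g , 2∣c) = trans (det-neg g) det-g , even-neg c 2∣c

Γ₀2-inv : ∀ g → InΓ₀2 g → InΓ₀2 (inv g)
Γ₀2-inv g@(mat a b c d) (det-g , 2∣c) = trans (det-inv g) det-g , even-neg c 2∣c

Γ₀2-resp-≈± : ∀ {g h} → g ≈± h → InΓ₀2 h → InΓ₀2 g
Γ₀2-resp-≈± (inj₁ refl) γ = γ
Γ₀2-resp-≈± {h = h} (inj₂ refl) γ = Γ₀2-neg h γ

Γ2-· : ∀ g h → InΓ2 g → InΓ2 h → InΓ2 (g · h)
Γ2-· g@(mat a b c d) h@(mat p q r s) (det-g , 2∣b , 2∣c) (det-h , 2∣q , 2∣r) =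
  trans (det-· g h) (cong₂ _*_ det-g det-h) ,
  even-+ (a * q) (b * s) (even-*ˡ a q 2∣q) (even-*ʳ b s 2∣b) ,
  even-+ (c * p) (d * r) (even-*ʳ c p 2∣c) (even-*ˡ d r 2∣r)

Γ2-neg : ∀ g → InΓ2 g → InΓ2 (neg g)
Γ2-neg g@(mat a b c d) (det-g , 2∣b , 2∣c) = trans (det-neg g) det-g , even-neg b 2∣b , even-neg c 2∣c

Γ2-inv : ∀ g → InΓ2 g → InΓ2 (inv g)
Γ2-inv g@(mat a b c d) (det-g , 2∣b , 2∣c) = trans (det-inv g) det-g , even-neg b 2∣b , even-neg c 2∣c

Γ2-resp-≈± : ∀ {g h} → g ≈± h → InΓ2 h → InΓ2 g
Γ2-resp-≈± (inj₁ refl) γ = γ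
Γ2-resp-≈± {h = h} (inj₂ refl) γ = Γ2-neg h γ

Γ2⇒Γ₀2 : ∀ g → InΓ2 g → InΓ₀2 g
Γ2⇒Γ₀2 _ (det-g , _ , 2∣c) = det-g , 2∣c

Γ2-I : InΓ2 I
Γ2-I = refl , even-0 , even-0

Γ₀2-I : InΓ₀2 I
Γ₀2-I = Γ2⇒Γ₀2 I Γ2-I

Γ2-U : InΓ2 U
Γ2-U = refl , even-0 , even-2

Γ₀2-U : InΓ₀2 U
Γ₀2-U = Γ2⇒Γ₀2 U Γ2-U

Γ₀2-V : InΓ₀2 V
Γ₀2-V = refl , even-2

¬Γ2-V : ¬ InΓ2 V
¬Γ2-V (_ , 2∣1 , _) = ¬even-1 2∣1

Γ₀2⇒odd-a : ∀ g → InΓ₀2 g → ¬ Even (a g)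
Γ₀2⇒odd-a (mat a b c d) (det-g , 2∣c) 2∣a =
  ¬even-1 (subst Even det-g (even-+ (a * d) (- (b * c)) (even-*ʳ a d 2∣a) (even-neg (b * c) (even-*ˡ b c 2∣c))))

even-·1 : ∀ x → Even (x * + 1) → Even x
even-·1 x = subst Even (ℤP.*-identityʳ x)

-- The b-entry of g · V is a + b, with a odd on Γ₀(2).
Γ2-·V : ∀ g → InΓ2 g → ¬ InΓ2 (g · V)
Γ2-·V (mat a b c d) (det-g , 2∣b , 2∣c) (_ , 2∣a+b , _) =
  Γ₀2⇒odd-a (mat a b c d) (det-g , 2∣c) (even-·1 a (even-+-cancelʳ (a * + 1) (b * + 1) 2∣a+b (even-*ʳ b (+ 1) 2∣b)))

Γ₀2∖Γ2-·V : ∀ g → InΓ₀2 g → ¬ InΓ2 g → InΓ2 (g · V)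
Γ₀2∖Γ2-·V g@(mat a b c d) γ@(det-g , 2∣c) g∉Γ2 =
  trans (det-· g V) (cong (_* + 1) det-g) ,
  odd-+-odd (a * + 1) (b * + 1) (λ 2∣a → Γ₀2⇒odd-a g γ (even-·1 a 2∣a)) (λ 2∣b → g∉Γ2 (det-g , even-·1 b 2∣b , 2∣c)) ,
  even-+ (c * - + 1) (d * - + 2) (even-*ʳ c (- + 1) 2∣c) (even-*ˡ d (- + 2) (even-neg (+ 2) even-2))

Γ2? : ∀ g → InΓ₀2 g → Dec (InΓ2 g)
Γ2? (mat a b c d) (det-g , 2∣c) with even? b
... | yes 2∣b = yes (det-g , 2∣b , 2∣c)
... | no 2∤b = no λ (_ , 2∣b , _) → 2∤b 2∣b

Γ₀2-powℕ : ∀ {x} k → InΓ₀2 x → InΓ₀2 (powℕ x k)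
Γ₀2-powℕ zero γ = Γ₀2-I
Γ₀2-powℕ {x} (suc k) γ = Γ₀2-· x (powℕ x k) γ (Γ₀2-powℕ k γ)

Γ2-powℕ : ∀ {x} k → InΓ2 x → InΓ2 (powℕ x k)
Γ2-powℕ zero γ = Γ2-I
Γ2-powℕ {x} (suc k) γ = Γ2-· x (powℕ x k) γ (Γ2-powℕ k γ)

Γ2-coset : ∀ g r → InΓ₀2 r → InΓ2 (g · inv r) → InΓ2 g ⇔ InΓ2 r
Γ2-coset g r (det-r , _) δ = mk⇔
  (λ γ → subst InΓ2 (inv-·-cancelˡ x r (proj₁ δ))
           (subst (λ m → InΓ2 (inv x · m)) (sym x·r≡g) (Γ2-· (inv x) g (Γ2-inv x δ) γ)))
  (λ γ → subst InΓ2 x·r≡g (Γ2-· x r δ γ))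
  where
  x = g · inv r
  x·r≡g = ·-inv-cancelʳ g r det-r

-- Generation of Γ(2)

T² : M2
T² = mat (+ 1) (+ 2) (+ 0) (+ 1)

data Γ2Generator : M2 → Set where
  U⁺  : Γ2Generator U
  U⁻  : Γ2Generator (inv U)
  T²⁺ : Γ2Generator T²
  T²⁻ : Γ2Generator (inv T²)

Γ2-generator : ∀ {x} → Γ2Generator x → InΓ2 x
Γ2-generator U⁺  = Γ2-U
Γ2-generator U⁻  = Γ2-inv U Γ2-U
Γ2-generator T²⁺ = refl , even-2 , even-0
Γ2-generator T²⁻ = Γ2-inv T² (Γ2-generator T²⁺)

U·-entries : ∀ a b c d → U · mat a b c d ≡ mat a b (c + + 2 * a) (d + + 2 * b)
U·-entries a b c d = mat-cong (upper a c) (upper b d) (lower a c) (lower b d)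
  where
  upper : ∀ x y → + 1 * x + + 0 * y ≡ x
  upper = solve-∀
  lower : ∀ x y → + 2 * x + + 1 * y ≡ y + + 2 * x
  lower = solve-∀

U⁻¹·-entries : ∀ a b c d → inv U · mat a b c d ≡ mat a b (c - + 2 * a) (d - + 2 * b)
U⁻¹·-entries a b c d = mat-cong (upper a c) (upper b d) (lower a c) (lower b d)
  where
  upper : ∀ x y → + 1 * x + - + 0 * y ≡ x
  upper = solve-∀
  lower : ∀ x y → - + 2 * x + + 1 * y ≡ y - + 2 * x
  lower = solve-∀

T²·-entries : ∀ a b c d → T² · mat a b c d ≡ mat (a + + 2 * c) (b + + 2 * d) c d
T²·-entries a b c d = mat-cong (upper a c) (upper b d) (lower a c) (lower b d)
  where
  upper : ∀ x y → + 1 * x + + 2 * y ≡ x + + 2 * y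
  upper = solve-∀
  lower : ∀ x y → + 0 * x + + 1 * y ≡ y
  lower = solve-∀

T⁻²·-entries : ∀ a b c d → inv T² · mat a b c d ≡ mat (a - + 2 * c) (b - + 2 * d) c d
T⁻²·-entries a b c d = mat-cong (upper a c) (upper b d) (lower a c) (lower b d)
  where
  upper : ∀ x y → + 1 * x + - + 2 * y ≡ x - + 2 * y
  upper = solve-∀
  lower : ∀ x y → - + 0 * x + + 1 * y ≡ y
  lower = solve-∀

∣m-2n∣<m : ∀ m n → 0 < n → n < m → ∣ + m - + 2 * + n ∣ < m
∣m-2n∣<m m n 0<n n<m rewrite sym (ℤP.pos-* 2 n) | ℤP.m-n≡m⊖n m (2 ℕ.* n) with ℕP.≤-total (2 ℕ.* n) m
... | inj₁ 2n≤m rewrite ℤP.⊖-≥ 2n≤m = ℕP.∸-monoʳ-< (ℕP.<-≤-trans 0<n (ℕP.m≤m+n n _)) 2n≤m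
... | inj₂ m≤2n rewrite ℤP.∣m⊖n∣≡∣n⊖m∣ m (2 ℕ.* n) | ℤP.⊖-≥ m≤2n =
  ℕP.m<n+o⇒m∸n<o (2 ℕ.* n) m {{ℕ.>-nonZero (ℕP.<-trans 0<n n<m)}}
    (subst (_< m ℕ.+ m) (cong (n ℕ.+_) (sym (ℕP.+-identityʳ n))) (ℕP.+-mono-< n<m n<m))

∣x∓2y∣<∣x∣ : ∀ x y → 0 < ∣ y ∣ → ∣ y ∣ < ∣ x ∣ → ∣ x - + 2 * y ∣ < ∣ x ∣ ⊎ ∣ x + + 2 * y ∣ < ∣ x ∣
∣x∓2y∣<∣x∣ (+ m) (+ n) 0<n n<m = inj₁ (∣m-2n∣<m m n 0<n n<m)
∣x∓2y∣<∣x∣ (+ m) -[1+ n ] 0<n n<m =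
  inj₂ (subst (λ z → ∣ z ∣ < m) (sym (identity (+ m) (+ suc n))) (∣m-2n∣<m m (suc n) 0<n n<m))
  where
  identity : ∀ x y → x + + 2 * - y ≡ x - + 2 * y
  identity = solve-∀
∣x∓2y∣<∣x∣ -[1+ m ] (+ n) 0<n n<m =
  inj₂ (subst (λ z → ∣ z ∣ < suc m) (sym (identity (+ suc m) (+ n)))
    (subst (_< suc m) (sym (ℤP.∣-i∣≡∣i∣ (+ suc m - + 2 * + n))) (∣m-2n∣<m (suc m) n 0<n n<m)))
  where
  identity : ∀ x y → - x + + 2 * y ≡ - (x - + 2 * y)
  identity = solve-∀
∣x∓2y∣<∣x∣ -[1+ m ] -[1+ n ] 0<n n<m =
  inj₁ (subst (λ z → ∣ z ∣ < suc m) (sym (identity (+ suc m) (+ suc n)))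
    (subst (_< suc m) (sym (ℤP.∣-i∣≡∣i∣ (+ suc m - + 2 * + suc n))) (∣m-2n∣<m (suc m) (suc n) 0<n n<m)))
  where
  identity : ∀ x y → - x - + 2 * - y ≡ - (x - + 2 * y)
  identity = solve-∀

∣x∣≡1 : ∀ x → ∣ x ∣ ≡ 1 → x ≡ + 1 ⊎ x ≡ - + 1
∣x∣≡1 (+ 1) refl = inj₁ refl
∣x∣≡1 -[1+ 0 ] refl = inj₂ refl

*≡1⇒∣∣≡1 : ∀ x y → x * y ≡ + 1 → ∣ x ∣ ≡ 1 × ∣ y ∣ ≡ 1
*≡1⇒∣∣≡1 x y xy≡1 = ℕP.m*n≡1⇒m≡1 (∣ x ∣) (∣ y ∣) ∣x∣∣y∣≡1 , ℕP.m*n≡1⇒n≡1 (∣ x ∣) (∣ y ∣) ∣x∣∣y∣≡1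
  where
  ∣x∣∣y∣≡1 : ∣ x ∣ ℕ.* ∣ y ∣ ≡ 1
  ∣x∣∣y∣≡1 = trans (sym (ℤP.abs-* x y)) (cong ∣_∣ xy≡1)

det-upper : ∀ a b d → det (mat a b (+ 0) d) ≡ a * d
det-upper a b d = identity a b d
  where
  identity : ∀ a b d → a * d - b * + 0 ≡ a * d
  identity = solve-∀

zero⊎pos : ∀ n → n ≡ 0 ⊎ 0 < n
zero⊎pos zero = inj₁ refl
zero⊎pos (suc n) = inj₂ (s≤s z≤n)

zero⊎one⊎>1 : ∀ n → n ≡ 0 ⊎ n ≡ 1 ⊎ 1 < n
zero⊎one⊎>1 zero = inj₁ refl
zero⊎one⊎>1 (suc zero) = inj₂ (inj₁ refl)
zero⊎one⊎>1 (suc (suc n)) = inj₂ (inj₂ (s≤s (s≤s z≤n)))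

Γ₀2⇒0<∣a∣ : ∀ g → InΓ₀2 g → 0 < ∣ a g ∣
Γ₀2⇒0<∣a∣ g γ with zero⊎pos ∣ a g ∣
... | inj₁ ∣a∣≡0 = ⊥-elim (Γ₀2⇒odd-a g γ (subst (2 ℕD.∣_) (sym ∣a∣≡0) (ℕD._∣0 2)))
... | inj₂ 0<∣a∣ = 0<∣a∣

-- Γ̄(2) = ⟨Ū, T̄²⟩, by descent on ∣a∣ + ∣c∣ and then, once c = 0, on ∣b∣.
module _ (P : M2 → Set) (P-I : P I) (P-neg-I : P (neg I))
         (descend : ∀ {x} g → Γ2Generator x → InΓ2 g → P (x · g) → P g) where

  private
    descend-to : ∀ {x g g′} → Γ2Generator x → x · g ≡ g′ → InΓ2 g → (InΓ2 g′ → P g′) → P g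
    descend-to {x} {g} gen x·g≡g′ γ P-g′ =
      descend g gen γ (subst P (sym x·g≡g′) (P-g′ (subst InΓ2 x·g≡g′ (Γ2-· x g (Γ2-generator gen) γ))))

    diagonal : ∀ a d → a * d ≡ + 1 → P (mat a (+ 0) (+ 0) d)
    diagonal a d ad≡1 with ∣x∣≡1 a (proj₁ (*≡1⇒∣∣≡1 a d ad≡1)) | ∣x∣≡1 d (proj₂ (*≡1⇒∣∣≡1 a d ad≡1))
    diagonal _ _ _  | inj₁ refl | inj₁ refl = P-I
    diagonal _ _ _  | inj₂ refl | inj₂ refl = P-neg-I
    diagonal _ _ () | inj₁ refl | inj₂ refl
    diagonal _ _ () | inj₂ refl | inj₁ refl

    upper : ∀ a b d → Acc _<_ ∣ b ∣ → InΓ2 (mat a b (+ 0) d) → P (mat a b (+ 0) d)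
    upper a b d (acc smaller) γ@(det≡1 , 2∣b , _) with zero⊎one⊎>1 ∣ b ∣
    ... | inj₁ ∣b∣≡0 = subst (λ b → P (mat a b (+ 0) d)) (sym (ℤP.∣i∣≡0⇒i≡0 ∣b∣≡0))
                         (diagonal a d (trans (sym (det-upper a b d)) det≡1))
    ... | inj₂ (inj₁ ∣b∣≡1) = ⊥-elim (¬even-1 (subst (2 ℕD.∣_) ∣b∣≡1 2∣b))
    ... | inj₂ (inj₂ 1<∣b∣)
          with ∣x∓2y∣<∣x∣ b d (subst (0 <_) (sym ∣d∣≡1) (s≤s z≤n)) (subst (_< ∣ b ∣) (sym ∣d∣≡1) 1<∣b∣)
      where ∣d∣≡1 = proj₂ (*≡1⇒∣∣≡1 a d (trans (sym (det-upper a b d)) det≡1))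
    ...   | inj₁ shorter = descend-to T²⁻ (T⁻²·-entries a b (+ 0) d) γ (upper _ _ d (smaller shorter))
    ...   | inj₂ shorter = descend-to T²⁺ (T²·-entries a b (+ 0) d) γ (upper _ _ d (smaller shorter))

    general : ∀ g → Acc _<_ (∣ a g ∣ ℕ.+ ∣ c g ∣) → InΓ2 g → P g
    general g@(mat a b c d) (acc smaller) γ@(det≡1 , _ , 2∣c) with zero⊎pos ∣ c ∣
    ... | inj₁ ∣c∣≡0 = subst (λ c → P (mat a b c d)) (sym c≡0)
                         (upper a b d (<-wellFounded ∣ b ∣) (subst (λ c → InΓ2 (mat a b c d)) c≡0 γ))
      where c≡0 = ℤP.∣i∣≡0⇒i≡0 ∣c∣≡0
    ... | inj₂ 0<∣c∣ with ℕP.<-cmp ∣ a ∣ ∣ c ∣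
    ...   | tri≈ _ ∣a∣≡∣c∣ _ = ⊥-elim (Γ₀2⇒odd-a g (Γ2⇒Γ₀2 g γ) (subst (2 ℕD.∣_) (sym ∣a∣≡∣c∣) 2∣c))
    ...   | tri< ∣a∣<∣c∣ _ _ with ∣x∓2y∣<∣x∣ c a (Γ₀2⇒0<∣a∣ g (Γ2⇒Γ₀2 g γ)) ∣a∣<∣c∣
    ...     | inj₁ shorter = descend-to U⁻ (U⁻¹·-entries a b c d) γ
                               (general _ (smaller (ℕP.+-monoʳ-< ∣ a ∣ shorter)))
    ...     | inj₂ shorter = descend-to U⁺ (U·-entries a b c d) γ
                               (general _ (smaller (ℕP.+-monoʳ-< ∣ a ∣ shorter)))
    general g@(mat a b c d) (acc smaller) γ | inj₂ 0<∣c∣ | tri> _ _ ∣c∣<∣a∣ with ∣x∓2y∣<∣x∣ a c 0<∣c∣ ∣c∣<∣a∣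
    ...     | inj₁ shorter = descend-to T²⁻ (T⁻²·-entries a b c d) γ
                               (general _ (smaller (ℕP.+-monoˡ-< ∣ c ∣ shorter)))
    ...     | inj₂ shorter = descend-to T²⁺ (T²·-entries a b c d) γ
                               (general _ (smaller (ℕP.+-monoˡ-< ∣ c ∣ shorter)))

  Γ2-induction : ∀ g → InΓ2 g → P g
  Γ2-induction g = general g (<-wellFounded _)

-- Characters of Γ₀(2)

•-character : ∀ {ψ} k → IsCharacter ψ → IsCharacter (λ g → k • ψ g)
•-character {ψ} k ψ-char = record
  { hom   = λ g h γ δ → ~⇒≡ℚ/ℤ (~-trans (~-• k (≡ℚ/ℤ⇒~ (IsCharacter.hom ψ-char g h γ δ)))
                                         (~-reflexive (•-distribˡ-+ k (ψ g) (ψ h))))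
  ; ±-inv = λ g γ → ~⇒≡ℚ/ℤ (~-• k (≡ℚ/ℤ⇒~ (IsCharacter.±-inv ψ-char g γ)))
  }

module Character {ψ : M2 → ℚ} (ψ-char : IsCharacter ψ) where

  ψ-· : ∀ g h → InΓ₀2 g → InΓ₀2 h → ψ (g · h) ~ ψ g ℚ.+ ψ h
  ψ-· g h γ δ = ≡ℚ/ℤ⇒~ (IsCharacter.hom ψ-char g h γ δ)

  ψ-neg : ∀ g → InΓ₀2 g → ψ (neg g) ~ ψ g
  ψ-neg g γ = ≡ℚ/ℤ⇒~ (IsCharacter.±-inv ψ-char g γ)

  ψ-I : Integral (ψ I)
  ψ-I = ~-double⇒integral (ψ-· I I Γ₀2-I Γ₀2-I)

  ψ-resp-≈± : ∀ {g h} → g ≈± h → InΓ₀2 h → ψ g ~ ψ h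
  ψ-resp-≈± (inj₁ refl) _ = ~-refl
  ψ-resp-≈± {h = h} (inj₂ refl) γ = ψ-neg h γ

  ψ-inv : ∀ g → InΓ₀2 g → ψ (inv g) ~ ℚ.- ψ g
  ψ-inv g γ@(det≡1 , _) = integral-+⇒~-neg (integral-resp-~ (~-sym (ψ-· (inv g) g (Γ₀2-inv g γ) γ))
    (subst (λ x → Integral (ψ x)) (sym (inv-inverseˡ g det≡1)) ψ-I))

  ψ-powℕ : ∀ x k → InΓ₀2 x → ψ (powℕ x k) ~ k • ψ x
  ψ-powℕ x zero γ = ~-trans (integral⇒~0 ψ-I) (~-reflexive (sym (•-zero (ψ x))))
  ψ-powℕ x (suc k) γ = ~-trans (ψ-· x (powℕ x k) γ (Γ₀2-powℕ k γ))
    (~-trans (~-+ (~-refl {ψ x}) (ψ-powℕ x k γ)) (~-reflexive (sym (•-suc k (ψ x)))))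

  -- T = V U, and V² = -I lies in every kernel.
  ψ-T² : ψ T² ~ ψ U ℚ.+ ψ U
  ψ-T² = begin
    ψ ((V · U) · (V · U))            ≈⟨ ψ-· (V · U) (V · U) Γ₀2-VU Γ₀2-VU ⟩
    ψ (V · U) ℚ.+ ψ (V · U)          ≈⟨ ~-+ (ψ-· V U Γ₀2-V Γ₀2-U) (ψ-· V U Γ₀2-V Γ₀2-U) ⟩
    (ψ V ℚ.+ ψ U) ℚ.+ (ψ V ℚ.+ ψ U)  ≡⟨ solve 2 (λ v u → (v :+ u) :+ (v :+ u) := (v :+ v) :+ (u :+ u)) refl (ψ V) (ψ U) ⟩
    (ψ V ℚ.+ ψ V) ℚ.+ (ψ U ℚ.+ ψ U)  ≈⟨ ~-+-integralˡ ψV+ψV ⟩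
    ψ U ℚ.+ ψ U                      ∎
    where
    open ~-Reasoning
    Γ₀2-VU = Γ₀2-· V U Γ₀2-V Γ₀2-U
    ψV+ψV : Integral (ψ V ℚ.+ ψ V)
    ψV+ψV = integral-resp-~ (~-sym (ψ-· V V Γ₀2-V Γ₀2-V)) (integral-resp-~ (ψ-neg I Γ₀2-I) ψ-I)

  integral-ψ-· : ∀ g h → InΓ₀2 g → InΓ₀2 h → Integral (ψ g) → Integral (ψ h) → Integral (ψ (g · h))
  integral-ψ-· g h γ δ i j = integral-resp-~ (ψ-· g h γ δ) (integral-+ i j)

  integral-ψ-cancelˡ : ∀ x g → InΓ₀2 x → InΓ₀2 g → Integral (ψ x) → Integral (ψ (x · g)) → Integral (ψ g)
  integral-ψ-cancelˡ x g γ δ i j = integral-+-cancelˡ i (integral-resp-~ (~-sym (ψ-· x g γ δ)) j)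

  integral-ψ-inv : ∀ g → InΓ₀2 g → Integral (ψ g) → Integral (ψ (inv g))
  integral-ψ-inv g γ i = integral-resp-~ (ψ-inv g γ) (integral-neg i)

  integral-ψ-coset : ∀ g r → InΓ₀2 r → InΓ₀2 (g · inv r) → Integral (ψ (g · inv r)) →
                     Integral (ψ g) ⇔ Integral (ψ r)
  integral-ψ-coset g r γ δ i = mk⇔
    (λ j → integral-ψ-cancelˡ (g · inv r) r δ γ i (subst (λ x → Integral (ψ x)) (sym x·r≡g) j))
    (λ j → subst (λ x → Integral (ψ x)) x·r≡g (integral-ψ-· (g · inv r) r δ γ i j))
    where x·r≡g = ·-inv-cancelʳ g r (proj₁ γ)

  Γ2⇒integral-ψ : Integral (ψ U) → ∀ g → InΓ2 g → Integral (ψ g)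
  Γ2⇒integral-ψ ψU = Γ2-induction (λ g → Integral (ψ g)) ψ-I (integral-resp-~ (ψ-neg I Γ₀2-I) ψ-I) descend
    where
    generator : ∀ {x} → Γ2Generator x → Integral (ψ x)
    generator U⁺  = ψU
    generator U⁻  = integral-ψ-inv U Γ₀2-U ψU
    generator T²⁺ = integral-resp-~ ψ-T² (integral-+ ψU ψU)
    generator T²⁻ = integral-ψ-inv T² (Γ2⇒Γ₀2 T² (Γ2-generator T²⁺)) (generator T²⁺)
    descend : ∀ {x} g → Γ2Generator x → InΓ2 g → Integral (ψ (x · g)) → Integral (ψ g)
    descend {x} g gen γ = integral-ψ-cancelˡ x g (Γ2⇒Γ₀2 x (Γ2-generator gen)) (Γ2⇒Γ₀2 g γ) (generator gen)

-- The subgroups H, H₀, H₁, H₂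

module Subgroups {θ : M2 → ℚ} (θ-char : IsCharacter θ) where
  open Character θ-char

  H H₀ H₁ H₂ : Pred
  H g = InΓ₀2 g × IsInt (θ g)
  H₀ = H ∩ InΓ2
  H₁ = H₀ ⟨ V ⟩
  H₂ = H ⟨ V ⟩

  H-resp-≈± : ∀ {g h} → g ≈± h → H h → H g
  H-resp-≈± g≈h (γ , i) = Γ₀2-resp-≈± g≈h γ , isInt (integral-resp-~ (ψ-resp-≈± g≈h γ) (integral i))

  H₀-resp-≈± : ∀ {g h} → g ≈± h → H₀ h → H₀ g
  H₀-resp-≈± g≈h (H-h , γ) = H-resp-≈± g≈h H-h , Γ2-resp-≈± g≈h γ

  H-I : H I
  H-I = Γ₀2-I , isInt ψ-I

  H₀-I : H₀ I
  H₀-I = H-I , Γ2-I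

  H₁⊆H₂ : ∀ {g} → H₁ g → H₂ g
  H₁⊆H₂ (h , k , (H-h , _) , g≈hVᵏ) = h , k , H-h , g≈hVᵏ

  same-H₀-coset-Γ2 : ∀ g r s → InΓ₀2 r → InΓ₀2 s → H₀ (g · inv r) → H₀ (g · inv s) → InΓ2 r → InΓ2 s
  same-H₀-coset-Γ2 g r s γ γ′ (_ , δ) (_ , δ′) = to (Γ2-coset g s γ′ δ′) ∘ from (Γ2-coset g r γ δ)

  same-H₀-coset-θ : ∀ g r s → InΓ₀2 r → InΓ₀2 s → H₀ (g · inv r) → H₀ (g · inv s) → Integral (θ r) → Integral (θ s)
  same-H₀-coset-θ g r s γ γ′ ((γx , i) , _) ((γx′ , i′) , _) =
    to (integral-ψ-coset g s γ′ γx′ (integral i′)) ∘ from (integral-ψ-coset g r γ γx (integral i))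

  ∈H₀·I : ∀ {g} h → H₀ h → g ≈± h → H₀ (g · inv I)
  ∈H₀·I {g} h H₀-h g≈h = H₀-resp-≈± (≈±-trans (≈±-reflexive (·-identityʳ g)) g≈h) H₀-h

  ∈H₀·V : ∀ {g} h → H₀ h → g ≈± (h · V) → H₀ (g · inv V)
  ∈H₀·V h H₀-h g≈hV = H₀-resp-≈± (≈±-trans (≈±-·ʳ (inv V) g≈hV) (≈±-reflexive (·-cancelʳ-inv h V refl))) H₀-h

  V∈H₁ : H₁ V
  V∈H₁ = ⟨V⟩-intro-·V {H₀} I H₀-I ≈±-refl

  index-H₁-H₀ : Index H₁ H₀ 2
  index-H₁-H₀ = record
    { rep      = rep
    ; rep∈     = λ { zero → ⟨V⟩-intro {H₀} I H₀-I ≈±-refl ; (suc zero) → V∈H₁ }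
    ; covers   = covers
    ; disjoint = disjoint
    }
    where
    rep : Fin 2 → M2
    rep zero = I
    rep (suc zero) = V
    covers : ∀ g → InSL2 g → H₁ g → ∃[ i ] H₀ (g · inv (rep i))
    covers g _ g∈H₁ with ⟨V⟩-cases {H₀} g∈H₁
    ... | h , H₀-h , inj₁ g≈h = zero , ∈H₀·I h H₀-h g≈h
    ... | h , H₀-h , inj₂ g≈hV = suc zero , ∈H₀·V h H₀-h g≈hV
    disjoint : ∀ g i j → InSL2 g → H₁ g → H₀ (g · inv (rep i)) → H₀ (g · inv (rep j)) → i ≡ j
    disjoint g zero zero _ _ _ _ = refl
    disjoint g (suc zero) (suc zero) _ _ _ _ = refl
    disjoint g zero (suc zero) _ _ p q = ⊥-elim (¬Γ2-V (same-H₀-coset-Γ2 g I V Γ₀2-I Γ₀2-V p q Γ2-I))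
    disjoint g (suc zero) zero _ _ p q = ⊥-elim (¬Γ2-V (same-H₀-coset-Γ2 g I V Γ₀2-I Γ₀2-V q p Γ2-I))

  module ε=+1 (θV : Integral (θ V)) where

    H-·V : ∀ h → H h → H (h · V)
    H-·V h (γ , i) = Γ₀2-· h V γ Γ₀2-V , isInt (integral-ψ-· h V γ Γ₀2-V (integral i) θV)

    H⊆H₁ : ∀ {g} → H g → H₁ g
    H⊆H₁ {g} H-g with Γ2? g (proj₁ H-g)
    ... | yes δ = ⟨V⟩-intro {H₀} g (H-g , δ) ≈±-refl
    ... | no g∉Γ2 = ⟨V⟩-intro-·V {H₀} (g · V) (H-·V g H-g , Γ₀2∖Γ2-·V g (proj₁ H-g) g∉Γ2) (·V·V-≈± g)

    H₁⊆H : ∀ {g} → H₁ g → H g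
    H₁⊆H g∈H₁ with ⟨V⟩-cases {H₀} g∈H₁
    ... | h , (H-h , _) , inj₁ g≈h = H-resp-≈± g≈h H-h
    ... | h , (H-h , _) , inj₂ g≈hV = H-resp-≈± g≈hV (H-·V h H-h)

    H₂⊆H₁ : ∀ {g} → H₂ g → H₁ g
    H₂⊆H₁ g∈H₂ with ⟨V⟩-cases {H} g∈H₂
    ... | h , H-h , inj₁ g≈h = H⊆H₁ (H-resp-≈± g≈h H-h)
    ... | h , H-h , inj₂ g≈hV = H⊆H₁ (H-resp-≈± g≈hV (H-·V h H-h))

    H≐H₁ : H ≐ H₁
    H≐H₁ _ _ = H⊆H₁ , H₁⊆H

    H₁≐H₂ : H₁ ≐ H₂
    H₁≐H₂ _ _ = H₁⊆H₂ , H₂⊆H₁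

  Γ2⇒integral-n•θ : ∀ n → Integral (n • θ U) → ∀ g → InΓ2 g → Integral (n • θ g)
  Γ2⇒integral-n•θ n = Character.Γ2⇒integral-ψ (•-character n θ-char)

  module ε=-1 (θV~½ : θ V ~ ½) where

    θV∉ℤ : ¬ Integral (θ V)
    θV∉ℤ i = ¬integral-½ (integral-resp-~ (~-sym θV~½) i)

    V∉H : ¬ H V
    V∉H (_ , i) = θV∉ℤ (integral i)

    θ-·V : ∀ g → InΓ₀2 g → Integral (θ g) → θ (g · V) ~ ½
    θ-·V g γ i = ~-trans (ψ-· g V γ Γ₀2-V) (~-trans (~-+ (integral⇒~0 i) θV~½) (~-reflexive (ℚP.+-identityˡ ½)))

    module n-odd (n : ℕ) (n•θU∈ℤ : Integral (n • θ U)) (n-odd : ¬ 2 ∣ n) where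

      H⊆Γ2 : ∀ {g} → H g → InΓ2 g
      H⊆Γ2 {g} (γ , i) with Γ2? g γ
      ... | yes δ = δ
      ... | no g∉Γ2 = ⊥-elim (n-odd (integral-•½⇒even n (integral-resp-~ (~-sym (~-• n (θ-·V g γ (integral i))))
                        (Γ2⇒integral-n•θ n n•θU∈ℤ (g · V) (Γ₀2∖Γ2-·V g γ g∉Γ2)))))

      H≐H₀ : H ≐ H₀
      H≐H₀ _ _ = (λ H-g → H-g , H⊆Γ2 H-g) , proj₁

      H₁≐H₂ : H₁ ≐ H₂
      H₁≐H₂ _ _ = H₁⊆H₂ , λ (h , k , H-h , g≈hVᵏ) → h , k , (H-h , H⊆Γ2 H-h) , g≈hVᵏ

    module n-even (n : ℕ) (n≢0 : NonZero n) (θU-primitive : PrimitiveRoot n (θ U)) (2∣n : 2 ∣ n) where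

      m : ℕ
      m = _∣_.quotient 2∣n

      n≡m*2 : n ≡ m ℕ.* 2
      n≡m*2 = _∣_.equality 2∣n

      0<m : 0 < m
      0<m with zero⊎pos m
      ... | inj₁ m≡0 = ⊥-elim (NonZero.nonZero (subst NonZero (trans n≡m*2 (cong (ℕ._* 2) m≡0)) n≢0))
      ... | inj₂ 0<m = 0<m

      m<n : m < n
      m<n = subst (m <_) (sym n≡m*2) (ℕP.m<m*n m 2 {{ℕ.>-nonZero 0<m}} (s≤s (s≤s z≤n)))

      2•m•θU∈ℤ : Integral (2 • (m • θ U))
      2•m•θU∈ℤ = subst Integral (sym (•-assoc 2 m (θ U)))
                   (subst (λ k → Integral (k • θ U)) n≡m*2 (integral (proj₁ θU-primitive)))

      m•θU+½∈ℤ : Integral (m • θ U ℚ.+ ½)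
      m•θU+½∈ℤ = fromInj₂ (λ m•θU∈ℤ → ⊥-elim (proj₂ θU-primitive m 0<m m<n (isInt m•θU∈ℤ)))
                          (integral-double⇒integral⊎half (m • θ U) 2•m•θU∈ℤ)

      -- χ(Uᵐ) = -1 = χ(V), so w lies in H but not in Γ(2).
      w : M2
      w = powℕ U m · V

      Γ2-Uᵐ : InΓ2 (powℕ U m)
      Γ2-Uᵐ = Γ2-powℕ m Γ2-U

      Γ₀2-w : InΓ₀2 w
      Γ₀2-w = Γ₀2-· (powℕ U m) V (Γ2⇒Γ₀2 (powℕ U m) Γ2-Uᵐ) Γ₀2-V

      θw∈ℤ : Integral (θ w)
      θw∈ℤ = integral-resp-~ (~-trans (ψ-· (powℕ U m) V (Γ2⇒Γ₀2 (powℕ U m) Γ2-Uᵐ) Γ₀2-V)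
                                     (~-+ (ψ-powℕ U m Γ₀2-U) θV~½))
               m•θU+½∈ℤ

      w∈H : H w
      w∈H = Γ₀2-w , isInt θw∈ℤ

      w∉Γ2 : ¬ InΓ2 w
      w∉Γ2 = Γ2-·V (powℕ U m) Γ2-Uᵐ

      Γ₀2-wV : InΓ₀2 (w · V)
      Γ₀2-wV = Γ₀2-· w V Γ₀2-w Γ₀2-V

      Γ2-wV : InΓ2 (w · V)
      Γ2-wV = Γ₀2∖Γ2-·V w Γ₀2-w w∉Γ2

      θwV∉ℤ : ¬ Integral (θ (w · V))
      θwV∉ℤ i = θV∉ℤ (integral-ψ-cancelˡ w V Γ₀2-w Γ₀2-V θw∈ℤ i)

      w∉H₁ : ¬ H₁ w
      w∉H₁ w∈H₁ with ⟨V⟩-cases {H₀} w∈H₁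
      ... | h , (_ , δ) , inj₁ w≈h = w∉Γ2 (Γ2-resp-≈± w≈h δ)
      ... | h , ((γ , i) , _) , inj₂ w≈hV = θV∉ℤ (integral-ψ-cancelˡ h V γ Γ₀2-V (integral i)
                                             (integral-resp-~ (~-sym (ψ-resp-≈± w≈hV (Γ₀2-· h V γ Γ₀2-V))) θw∈ℤ))

      ∈H₀·w : ∀ h → H h → ¬ InΓ2 h → H₀ (h · inv w)
      ∈H₀·w h (γ , i) h∉Γ2 =
        (Γ₀2-· h (inv w) γ (Γ₀2-inv w Γ₀2-w) ,
         isInt (integral-ψ-· h (inv w) γ (Γ₀2-inv w Γ₀2-w) (integral i) (integral-ψ-inv w Γ₀2-w θw∈ℤ))) ,
        subst InΓ2 (·-inv-·-cancelʳ h V w refl) (Γ2-· (h · V) (inv (w · V)) (Γ₀2∖Γ2-·V h γ h∉Γ2) (Γ2-inv (w · V) Γ2-wV))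

      ∈H₀·wV : ∀ {g} h → H h → ¬ InΓ2 h → g ≈± (h · V) → H₀ (g · inv (w · V))
      ∈H₀·wV h H-h h∉Γ2 g≈hV =
        H₀-resp-≈± (≈±-trans (≈±-·ʳ (inv (w · V)) g≈hV) (≈±-reflexive (·-inv-·-cancelʳ h V w refl))) (∈H₀·w h H-h h∉Γ2)

      -- Membership in Γ(2) and in ker θ: I (yes, yes), V (no, no), w (no, yes), w V (yes, no).
      rep : Fin 4 → M2
      rep zero = I
      rep (suc zero) = V
      rep (suc (suc zero)) = w
      rep (suc (suc (suc zero))) = w · V

      Γ₀2-rep : ∀ i → InΓ₀2 (rep i)
      Γ₀2-rep zero = Γ₀2-I
      Γ₀2-rep (suc zero) = Γ₀2-V
      Γ₀2-rep (suc (suc zero)) = Γ₀2-w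
      Γ₀2-rep (suc (suc (suc zero))) = Γ₀2-wV

      rep∈H₂ : ∀ i → H₂ (rep i)
      rep∈H₂ zero = ⟨V⟩-intro {H} I H-I ≈±-refl
      rep∈H₂ (suc zero) = H₁⊆H₂ V∈H₁
      rep∈H₂ (suc (suc zero)) = ⟨V⟩-intro {H} w w∈H ≈±-refl
      rep∈H₂ (suc (suc (suc zero))) = ⟨V⟩-intro-·V {H} w w∈H ≈±-refl

      H₂-covered : ∀ g → InSL2 g → H₂ g → ∃[ i ] H₀ (g · inv (rep i))
      H₂-covered g _ g∈H₂ with ⟨V⟩-cases {H} g∈H₂
      ... | h , H-h , g≈h∨g≈hV with Γ2? h (proj₁ H-h) | g≈h∨g≈hV
      ...   | yes δ    | inj₁ g≈h  = zero , ∈H₀·I h (H-h , δ) g≈h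
      ...   | yes δ    | inj₂ g≈hV = suc zero , ∈H₀·V h (H-h , δ) g≈hV
      ...   | no h∉Γ2 | inj₁ g≈h  = suc (suc zero) , H₀-resp-≈± (≈±-·ʳ (inv w) g≈h) (∈H₀·w h H-h h∉Γ2)
      ...   | no h∉Γ2 | inj₂ g≈hV = suc (suc (suc zero)) , ∈H₀·wV h H-h h∉Γ2 g≈hV

      Γ2-separates : ∀ g i j → H₀ (g · inv (rep i)) → H₀ (g · inv (rep j)) → InΓ2 (rep i) → ¬ InΓ2 (rep j) → ⊥
      Γ2-separates g i j p q rᵢ∈Γ2 rⱼ∉Γ2 = rⱼ∉Γ2 (same-H₀-coset-Γ2 g (rep i) (rep j) (Γ₀2-rep i) (Γ₀2-rep j) p q rᵢ∈Γ2)

      θ-separates : ∀ g i j → H₀ (g · inv (rep i)) → H₀ (g · inv (rep j)) →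
                    Integral (θ (rep i)) → ¬ Integral (θ (rep j)) → ⊥
      θ-separates g i j p q θrᵢ∈ℤ θrⱼ∉ℤ = θrⱼ∉ℤ (same-H₀-coset-θ g (rep i) (rep j) (Γ₀2-rep i) (Γ₀2-rep j) p q θrᵢ∈ℤ)

      H₂-disjoint : ∀ g i j → InSL2 g → H₂ g → H₀ (g · inv (rep i)) → H₀ (g · inv (rep j)) → i ≡ j
      H₂-disjoint g zero zero _ _ _ _ = refl
      H₂-disjoint g (suc zero) (suc zero) _ _ _ _ = refl
      H₂-disjoint g (suc (suc zero)) (suc (suc zero)) _ _ _ _ = refl
      H₂-disjoint g (suc (suc (suc zero))) (suc (suc (suc zero))) _ _ _ _ = refl
      H₂-disjoint g zero (suc zero) _ _ p q = ⊥-elim (Γ2-separates g zero (suc zero) p q Γ2-I ¬Γ2-V)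
      H₂-disjoint g (suc zero) zero _ _ p q = ⊥-elim (Γ2-separates g zero (suc zero) q p Γ2-I ¬Γ2-V)
      H₂-disjoint g zero (suc (suc zero)) _ _ p q = ⊥-elim (Γ2-separates g zero (suc (suc zero)) p q Γ2-I w∉Γ2)
      H₂-disjoint g (suc (suc zero)) zero _ _ p q = ⊥-elim (Γ2-separates g zero (suc (suc zero)) q p Γ2-I w∉Γ2)
      H₂-disjoint g zero (suc (suc (suc zero))) _ _ p q = ⊥-elim (θ-separates g zero (suc (suc (suc zero))) p q ψ-I θwV∉ℤ)
      H₂-disjoint g (suc (suc (suc zero))) zero _ _ p q = ⊥-elim (θ-separates g zero (suc (suc (suc zero))) q p ψ-I θwV∉ℤ)
      H₂-disjoint g (suc zero) (suc (suc zero)) _ _ p q = ⊥-elim (θ-separates g (suc (suc zero)) (suc zero) q p θw∈ℤ θV∉ℤ)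
      H₂-disjoint g (suc (suc zero)) (suc zero) _ _ p q = ⊥-elim (θ-separates g (suc (suc zero)) (suc zero) p q θw∈ℤ θV∉ℤ)
      H₂-disjoint g (suc zero) (suc (suc (suc zero))) _ _ p q =
        ⊥-elim (Γ2-separates g (suc (suc (suc zero))) (suc zero) q p Γ2-wV ¬Γ2-V)
      H₂-disjoint g (suc (suc (suc zero))) (suc zero) _ _ p q =
        ⊥-elim (Γ2-separates g (suc (suc (suc zero))) (suc zero) p q Γ2-wV ¬Γ2-V)
      H₂-disjoint g (suc (suc zero)) (suc (suc (suc zero))) _ _ p q =
        ⊥-elim (Γ2-separates g (suc (suc (suc zero))) (suc (suc zero)) q p Γ2-wV w∉Γ2)
      H₂-disjoint g (suc (suc (suc zero))) (suc (suc zero)) _ _ p q =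
        ⊥-elim (Γ2-separates g (suc (suc (suc zero))) (suc (suc zero)) p q Γ2-wV w∉Γ2)

      index-H₂-H₀ : Index H₂ H₀ 4
      index-H₂-H₀ = record { rep = rep ; rep∈ = rep∈H₂ ; covers = H₂-covered ; disjoint = H₂-disjoint }

      ¬H≐H₀ : ¬ (H ≐ H₀)
      ¬H≐H₀ H≐H₀ = w∉Γ2 (proj₂ (proj₁ (H≐H₀ w (proj₁ Γ₀2-w)) w∈H))

      ¬H≐H₁ : ¬ (H ≐ H₁)
      ¬H≐H₁ H≐H₁ = V∉H (proj₂ (H≐H₁ V refl) V∈H₁)

      ¬H≐H₂ : ¬ (H ≐ H₂)
      ¬H≐H₂ H≐H₂ = V∉H (proj₂ (H≐H₂ V refl) (H₁⊆H₂ V∈H₁))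

      ¬H₀≐H₁ : ¬ (H₀ ≐ H₁)
      ¬H₀≐H₁ H₀≐H₁ = V∉H (proj₁ (proj₂ (H₀≐H₁ V refl) V∈H₁))

      ¬H₀≐H₂ : ¬ (H₀ ≐ H₂)
      ¬H₀≐H₂ H₀≐H₂ = V∉H (proj₁ (proj₂ (H₀≐H₂ V refl) (H₁⊆H₂ V∈H₁)))

      ¬H₁≐H₂ : ¬ (H₁ ≐ H₂)
      ¬H₁≐H₂ H₁≐H₂ = w∉H₁ (proj₂ (H₁≐H₂ w (proj₁ Γ₀2-w)) (⟨V⟩-intro {H} w w∈H ≈±-refl))

  classification : ∀ n → NonZero n → PrimitiveRoot n (θ U) → ∀ ε → θ V ≡ℚ/ℤ signℚ ε → Dec (2 ∣ n) →
    (¬ (2 ∣ n) × ε ≡ Sign.- × H ≐ H₀ × H₁ ≐ H₂) ⊎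
    (¬ (2 ∣ n) × ε ≡ Sign.+ × H ≐ H₁ × H₁ ≐ H₂) ⊎
    (2 ∣ n × ε ≡ Sign.- × ¬ (H ≐ H₀) × ¬ (H ≐ H₁) × ¬ (H ≐ H₂) × ¬ (H₀ ≐ H₁) × ¬ (H₀ ≐ H₂) × ¬ (H₁ ≐ H₂) ×
       Index H₂ H₀ 4) ⊎
    (2 ∣ n × ε ≡ Sign.+ × H ≐ H₁ × H₁ ≐ H₂)
  classification n _ θU-primitive Sign.- θV≡½ (no n-odd) = inj₁ (n-odd , refl , H≐H₀ , H₁≐H₂)
    where open ε=-1.n-odd (≡ℚ/ℤ⇒~ θV≡½) n (integral (proj₁ θU-primitive)) n-odd
  classification n _ _ Sign.+ θV≡0 (no n-odd) = inj₂ (inj₁ (n-odd , refl , H≐H₁ , H₁≐H₂))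
    where open ε=+1 (~0⇒integral (≡ℚ/ℤ⇒~ θV≡0))
  classification n n≢0 θU-primitive Sign.- θV≡½ (yes n-even) =
    inj₂ (inj₂ (inj₁ (n-even , refl , ¬H≐H₀ , ¬H≐H₁ , ¬H≐H₂ , ¬H₀≐H₁ , ¬H₀≐H₂ , ¬H₁≐H₂ , index-H₂-H₀)))
    where open ε=-1.n-even (≡ℚ/ℤ⇒~ θV≡½) n n≢0 θU-primitive n-even
  classification n _ _ Sign.+ θV≡0 (yes n-even) = inj₂ (inj₂ (inj₂ (n-even , refl , H≐H₁ , H₁≐H₂)))
    where open ε=+1 (~0⇒integral (≡ℚ/ℤ⇒~ θV≡0))

exactlyOne4-by-parity-and-sign : ∀ {n} {ε : Sign} {A B C D : Set} →
  (¬ (2 ∣ n) × ε ≡ Sign.- × A) ⊎ (¬ (2 ∣ n) × ε ≡ Sign.+ × B) ⊎ (2 ∣ n × ε ≡ Sign.- × C) ⊎ (2 ∣ n × ε ≡ Sign.+ × D) →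
  ExactlyOne4 (¬ (2 ∣ n) × ε ≡ Sign.- × A) (¬ (2 ∣ n) × ε ≡ Sign.+ × B) (2 ∣ n × ε ≡ Sign.- × C) (2 ∣ n × ε ≡ Sign.+ × D)
exactlyOne4-by-parity-and-sign alternatives =
  alternatives ,
  (λ { ((_ , refl , _) , (_ , () , _)) }) ,
  (λ { ((odd , _) , (even , _)) → odd even }) ,
  (λ { ((odd , _) , (even , _)) → odd even }) ,
  (λ { ((odd , _) , (even , _)) → odd even }) ,
  (λ { ((odd , _) , (even , _)) → odd even }) ,
  (λ { ((_ , refl , _) , (_ , () , _)) })

lemma3p2 : (θ : M2 → ℚ) → IsCharacter θ → (n : ℕ) → NonZero n →
    PrimitiveRoot n (θ U) → (ε : Sign) → θ V ≡ℚ/ℤ signℚ ε →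
    let H  = λ g → InΓ₀2 g × IsInt (θ g)
        H₀ = H ∩ InΓ2
        H₁ = H₀ ⟨ V ⟩
        H₂ = H ⟨ V ⟩
    in ExactlyOne4
         (¬ (2 ∣ n) × ε ≡ Sign.- × H ≐ H₀ × H₁ ≐ H₂)
         (¬ (2 ∣ n) × ε ≡ Sign.+ × H ≐ H₁ × H₁ ≐ H₂)
         (2 ∣ n × ε ≡ Sign.- ×
            ¬ (H ≐ H₀) × ¬ (H ≐ H₁) × ¬ (H ≐ H₂) ×
            ¬ (H₀ ≐ H₁) × ¬ (H₀ ≐ H₂) × ¬ (H₁ ≐ H₂) ×
            Index H₂ H₀ 4)
         (2 ∣ n × ε ≡ Sign.+ × H ≐ H₁ × H₁ ≐ H₂)
       × Index H₁ H₀ 2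
lemma3p2 θ θ-char n n≢0 θU-primitive ε θV≡ε =
  exactlyOne4-by-parity-and-sign (classification n n≢0 θU-primitive ε θV≡ε (2 ∣? n)) , index-H₁-H₀
  where open Subgroups θ-char
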